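{- Let $G_{\mathrm{inv}}=(\{x,y\},\{x_j\mapsto q^jy_jx_{j+1},\ y_j\mapsto q^jy_jx_{j+1}\},\mathrm{AIO})$ with $q$-derivative $D$, and $\phi(x_j)=x$, $\phi(y_j)=y$. Then for every $i\ge0$, $$\phi\big(\mathrm{Gen}_q^{(G_{\mathrm{inv}})}(x_i^{ -1};u)\big)=\frac{1-x^{ -1}y\,e_q\big((x-y)uq^i\big)}{x-y},\qquad \phi\big(\mathrm{Gen}_q^{(G_{\mathrm{inv}})}(y_i^{ -1};u)\big)=\frac{1-xy^{ -1}E_q\big((y-x)uq^i\big)}{y-x}.$$
   Context: $\mathbb{K}$ is a commutative ring with unity of characteristic zero, $q$ an indeterminate. Variables $x_i,y_i$ ($i\ge0$) form $\mathbb{S}$; $\mathbb{E}=\mathbb{K}[q][F(\mathbb{S})]$ is the group algebra of the free group on $\mathbb{S}$. The rule $R(x_j)=q^jy_jx_{j+1}$, $R(y_j)=q^jy_jx_{j+1}$ is extended to inverses by $R(s_i^{ -1})=-s_i^{ -1}R(s_i)s_{i+1}^{ -1}$. $\uparrow$ replaces every letter $s_i^{\pm1}$ by $s_{i+1}^{\pm1}$. AIO stably sorts the letters of a word according to $x_0<y_0<x_1<y_1<\cdots$ (a letter $s_i^{ -1}$ ranked as $s_i$). The $q$-derivative is $D(w_1\cdots w_n)=\sum_{j=1}^n\mathrm{AIO}\big(w_1\cdots w_{j-1}R(w_j)\uparrow(w_{j+1}\cdots w_n)\big)$, extended linearly. $\phi$ is extended to a $\mathbb{K}[q]$-algebra homomorphism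 with $\phi(s_i^{ -1})=\phi(s_i)^{ -1}$. $(a;q)_n=\prod_{k=0}^{n-1}(1-aq^k)$, $\mathrm{Gen}_q^{(G)}(f;u)=\sum_{n\ge0}D^n(f)\frac{u^n}{(q;q)_n}$ with $\phi$ applied coefficientwise; $e_q(u)=\sum_{n\ge0}\frac{u^n}{(q;q)_n}$, $E_q(u)=\sum_{n\ge0}q^{\binom n2}\frac{u^n}{(q;q)_n}$. -}

module Defs where

open import Data.Bool using (Bool; true; false; if_then_else_; not; _∧_)
open import Data.Nat using (ℕ; zero; suc; _≤ᵇ_; _≡ᵇ_) renaming (_*_ to _*ℕ_; _+_ to _+ℕ_)
open import Data.Integer using (ℤ; +_; -[1+_]) renaming (_*_ to _*ℤ_)
open import Data.List using (List; []; _∷_; _++_; map; foldr; concatMap)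
open import Data.Product using (_×_; _,_)
open import Algebra.Bundles using (CommutativeRing)

data Sym : Set where
  X Y : Sym

record Letter : Set where
  constructor letter
  field
    sym   : Sym
    idx   : ℕ
    inv   : Bool
open Letter public

Word : Set
Word = List Letter

xL yL xI yI : ℕ → Letter
xL i = letter X i false
yL i = letter Y i false
xI i = letter X i true
yI i = letter Y i true

sym≡ᵇ : Sym → Sym → Bool
sym≡ᵇ X X = true
sym≡ᵇ Y Y = true
sym≡ᵇ _ _ = false

cancels : Letter → Letter → Bool
cancels a b = sym≡ᵇ (sym a) (sym b) ∧ (idx a ≡ᵇ idx b) ∧ not (inv a ≡B inv b)
  where
  _≡B_ : Bool → Bool → Bool
  true ≡B true = true
  false ≡B false = true
  _ ≡B _ = false

reduceStep : Letter → Word → Word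
reduceStep a [] = a ∷ []
reduceStep a (b ∷ bs) = if cancels a b then bs else a ∷ b ∷ bs

reduce : Word → Word
reduce = foldr reduceStep []

key : Letter → ℕ
key (letter X i _) = 2 *ℕ i
key (letter Y i _) = suc (2 *ℕ i)

insertStable : Letter → Word → Word
insertStable a [] = a ∷ []
insertStable a (b ∷ bs) = if key a ≤ᵇ key b then a ∷ b ∷ bs else b ∷ insertStable a bs

AIO : Word → Word
AIO = foldr insertStable []

-- Elements of 𝔼 = 𝕂[q][F(𝕊)] arising here: finite ℤ-linear combinations
-- of terms  c · q^e · w  (c ∈ ℤ, e ∈ ℕ, w a reduced word)

record Term : Set where
  constructor term
  field
    coef : ℤ
    qexp : ℕ
    word : Word
open Term public

Elem : Set
Elem = List Term

shiftL : Letter → Letter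
shiftL (letter s i b) = letter s (suc i) b

up : Word → Word
up = map shiftL

-- the rule of G_inv:  R(x_j) = q^j y_j x_{j+1},  R(y_j) = q^j y_j x_{j+1},
-- R(s_j^{-1}) = - s_j^{-1} R(s_j) s_{j+1}^{-1}
Rule : Letter → Elem
Rule (letter s j false) = term (+ 1) j (yL j ∷ xL (suc j) ∷ []) ∷ []
Rule (letter s j true)  =
  term -[1+ 0 ] j (letter s j true ∷ yL j ∷ xL (suc j) ∷ letter s (suc j) true ∷ []) ∷ []

splits : Word → List (Word × Letter × Word)
splits [] = []
splits (a ∷ as) = ([] , a , as) ∷ map (λ { (p , b , r) → (a ∷ p , b , r) }) (splits as)

-- D(w_1⋯w_n) = Σ_j AIO(w_1⋯w_{j-1} R(w_j) ↑(w_{j+1}⋯w_n)),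
-- each resulting word read as an element of F(𝕊) (freely reduced)
Dword : Word → Elem
Dword w = concatMap
  (λ { (p , a , r) →
        map (λ t → term (coef t) (qexp t) (reduce (AIO (p ++ word t ++ up r)))) (Rule a) })
  (splits w)

D : Elem → Elem
D = concatMap (λ t → map (λ t' → term (coef t *ℤ coef t') (qexp t +ℕ qexp t') (word t')) (Dword (word t)))

Dⁿ : ℕ → Elem → Elem
Dⁿ zero f = f
Dⁿ (suc n) f = D (Dⁿ n f)

single : Letter → Elem
single a = term (+ 1) 0 (a ∷ []) ∷ []

module InRing {c ℓ} (R : CommutativeRing c ℓ) where
  open CommutativeRing R hiding (zero)

  infixr 8 _^_
  _^_ : Carrier → ℕ → Carrier
  a ^ zero = 1#
  a ^ suc n = a * (a ^ n)

  natR : ℕ → Carrier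
  natR zero = 0#
  natR (suc n) = 1# + natR n

  intR : ℤ → Carrier
  intR (+ n) = natR n
  intR -[1+ n ] = - natR (suc n)

  qPoch : Carrier → ℕ → Carrier
  qPoch q zero = 1#
  qPoch q (suc n) = qPoch q n * (1# - q ^ suc n)

  binom2 : ℕ → ℕ
  binom2 zero = zero
  binom2 (suc n) = n +ℕ binom2 n

  module Φ (q x x⁻¹ y y⁻¹ : Carrier) where
    φL : Letter → Carrier
    φL (letter X _ false) = x
    φL (letter X _ true)  = x⁻¹
    φL (letter Y _ false) = y
    φL (letter Y _ true)  = y⁻¹

    φW : Word → Carrier
    φW = foldr (λ a r → φL a * r) 1#

    φ : Elem → Carrier
    φ = foldr (λ t r → intR (coef t) * (q ^ qexp t) * φW (word t) + r) 0#

  -- A q-exponential series  Σ_n a_n u^n/(q;q)_n  is stored via its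
  -- normalised coefficient sequence  n ↦ a_n  (so no division is needed).
  QSeries : Set c
  QSeries = ℕ → Carrier

  _≋_ : QSeries → QSeries → Set ℓ
  f ≋ g = ∀ n → f n ≈ g n

  _·_ : Carrier → QSeries → QSeries
  (a · f) n = a * f n

  _⊖_ : QSeries → QSeries → QSeries
  (f ⊖ g) n = f n - g n

  one : QSeries
  one zero = 1#
  one (suc n) = 0#

  -- e_q(z u) = Σ z^n u^n/(q;q)_n
  e-q : Carrier → QSeries
  e-q z n = z ^ n

  -- E_q(z u) = Σ q^{binom(n,2)} z^n u^n/(q;q)_n
  E-q : Carrier → Carrier → QSeries
  E-q q z n = q ^ binom2 n * z ^ n

  -- φ(Gen_q(f;u)) = Σ φ(D^n f) u^n/(q;q)_n
  Gen : (q x x⁻¹ y y⁻¹ : Carrier) → Elem → QSeries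
  Gen q x x⁻¹ y y⁻¹ f n = Φ.φ q x x⁻¹ y y⁻¹ (Dⁿ n f)

{-# OPTIONS --safe #-}
-- Elements of 𝔼 are tested against arbitrary functionals g on words through their linear
-- extension eval g, of which φ is an instance, and eval g ∘ D = eval (Dᵀ g) with Dᵀ g w = eval g (D w);
-- so every formula for Dⁿ is proved for all g at once, by induction on n.
-- On a word whose letters strictly increase in the AIO order, D acts letter by letter without
-- re-sorting, and free reduction only cancels the pair s_{j+1} s_{j+1}⁻¹ or s_j⁻¹ s_j created
-- by R. Hence D(x_i⁻¹) = −q^i x_i⁻¹ y_i and D(y_i⁻¹) = −q^i x_{i+1} y_{i+1}⁻¹, and since
-- R(x_j) = R(y_j), D(x_j W − y_j W) = x_j D(W) − y_j D(W) when W only involves higher indices.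
-- Induction then gives
--   D^{k+1}(x_i⁻¹) = −q^{(k+1)i} x_i⁻¹ y_i ∏_{m=i+1}^{i+k} (x_m − y_m),
--   D^{k+1}(y_i⁻¹) = −q^{binom(k+1,2)+(k+1)i} ∏_{m=i+1}^{i+k} (y_m − x_m) x_{i+k+1} y_{i+k+1}⁻¹
-- (the first because D kills ∏ (x_m − y_m)), and φ maps them to the coefficients of the series.
module Submission where

open import Defs
open import Algebra.Bundles using (CommutativeRing)
open import Data.Bool using (true; false; not; T)
open import Data.Bool.Properties using (T-∧)
open import Data.Empty using (⊥-elim)
open import Data.Integer as ℤ using (-[1+_]; _◃_) renaming (_*_ to _*ℤ_)
open import Data.List using ([]; _∷_; _++_; map; concatMap; foldr)
open import Data.List.Properties using (map-++)
open import Data.List.Relation.Unary.All as All using (All; []; _∷_)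
open import Data.List.Relation.Unary.All.Properties using (++⁺; ++⁻; map⁺)
open import Data.List.Relation.Unary.AllPairs as AllPairs using (AllPairs; []; _∷_)
import Data.List.Relation.Unary.AllPairs.Properties as AllPairsₚ
open import Data.Nat using (ℕ; zero; suc; _≤_; _<_; _≤ᵇ_; s≤s) renaming (_*_ to _*ℕ_; _+_ to _+ℕ_)
import Data.Nat.Properties as ℕₚ
open ℕₚ using (≤-refl; ≤-trans; <-trans; ≤-<-trans; <⇒≤; <-irrefl; <-≤-trans; n≤1+n; n<1+n; ≤⇒≤ᵇ;
              ≡ᵇ⇒≡; ≡⇒≡ᵇ; *-suc; *-monoʳ-≤; ≤-reflexive; module ≤-Reasoning)
open import Data.Product using (_×_; _,_; proj₁)
import Data.Sign as Sign
open import Function using (_∘_; _$_; Equivalence)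
open import Relation.Nullary using (¬_)
import Relation.Binary.PropositionalEquality as ≡
open ≡ using (_≡_; refl; cong; cong₂; trans)

-- The AIO order and increasing words

-- A record rather than key a < key c, so that a and c can be inferred from a proof.
record _≺_ (a c : Letter) : Set where
  constructor mk≺
  field key< : key a < key c
open _≺_

≺-trans : ∀ {a b c} → a ≺ b → b ≺ c → a ≺ c
≺-trans (mk≺ a<b) (mk≺ b<c) = mk≺ (<-trans a<b b<c)

≤-≺-trans : ∀ {a b c} → key a ≤ key b → b ≺ c → a ≺ c
≤-≺-trans a≤b (mk≺ b<c) = mk≺ (≤-<-trans a≤b b<c)

≺-≤-trans : ∀ {a b c} → a ≺ b → key b ≤ key c → a ≺ c
≺-≤-trans (mk≺ a<b) b≤c = mk≺ (<-≤-trans a<b b≤c)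

Increasing : Word → Set
Increasing = AllPairs _≺_

IncreasingFrom : ℕ → Word → Set
IncreasingFrom j w = Increasing w × All (λ c → j ≤ idx c) w

_⁻¹ : Letter → Letter
letter s j v ⁻¹ = letter s j (not v)

key-⁻¹ : ∀ c → key (c ⁻¹) ≡ key c
key-⁻¹ (letter X _ _) = refl
key-⁻¹ (letter Y _ _) = refl

key-shiftL : ∀ c → key (shiftL c) ≡ 2 +ℕ key c
key-shiftL (letter X i _) = *-suc 2 i
key-shiftL (letter Y i _) = cong suc (*-suc 2 i)

2*idx≤key : ∀ c → 2 *ℕ idx c ≤ key c
2*idx≤key (letter X _ _) = ≤-refl
2*idx≤key (letter Y _ _) = n≤1+n _

key≤1+2*idx : ∀ c → key c ≤ suc (2 *ℕ idx c)
key≤1+2*idx (letter X _ _) = n≤1+n _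
key≤1+2*idx (letter Y _ _) = ≤-refl

X≺Y : ∀ j u v → letter X j u ≺ letter Y j v
X≺Y j u v = mk≺ ≤-refl

≺-idx : ∀ {a c} → idx a < idx c → a ≺ c
≺-idx {a} {c} lt = mk≺ $ begin-strict
    key a                  ≤⟨ key≤1+2*idx a ⟩
    suc (2 *ℕ idx a)       <⟨ n<1+n _ ⟩
    2 +ℕ 2 *ℕ idx a         ≡⟨ ≡.sym (*-suc 2 (idx a)) ⟩
    2 *ℕ suc (idx a)       ≤⟨ *-monoʳ-≤ 2 lt ⟩
    2 *ℕ idx c             ≤⟨ 2*idx≤key c ⟩
    key c                  ∎
  where open ≤-Reasoning

≺-shiftL : ∀ {a c} → a ≺ c → shiftL a ≺ shiftL c
≺-shiftL {a} {c} (mk≺ lt) = mk≺ (≡.subst₂ _<_ (≡.sym (key-shiftL a)) (≡.sym (key-shiftL c)) (s≤s (s≤s lt)))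

≺-shiftLʳ : ∀ {a c} → a ≺ c → a ≺ shiftL c
≺-shiftLʳ {a} {c} (mk≺ lt) = mk≺ (≡.subst (key a <_) (≡.sym (key-shiftL c)) (≤-trans lt (≤-trans (n≤1+n _) (n≤1+n _))))

Increasing-up : ∀ {w} → Increasing w → Increasing (up w)
Increasing-up inc = AllPairsₚ.map⁺ (AllPairs.map ≺-shiftL inc)

Increasing-∷ : ∀ {a b w} → a ≺ b → Increasing (b ∷ w) → Increasing (a ∷ b ∷ w)
Increasing-∷ a≺b inc@(b≺w ∷ _) = (a≺b ∷ All.map (≺-trans a≺b) b≺w) ∷ inc

Increasing-lowerHead : ∀ {a b w} → key a ≤ key b → Increasing (b ∷ w) → Increasing (a ∷ w)
Increasing-lowerHead a≤b (b≺w ∷ inc) = All.map (≤-≺-trans a≤b) b≺w ∷ inc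

IncreasingFrom-∷ : ∀ {j w} s v → IncreasingFrom (suc j) w → IncreasingFrom j (letter s j v ∷ w)
IncreasingFrom-∷ s v (inc , j<w) = (All.map ≺-idx j<w ∷ inc) , (≤-refl ∷ All.map <⇒≤ j<w)

-- Sorting and free reduction

insertStable-All : ∀ {P : Letter → Set} {a w} → P a → All P w → All P (insertStable a w)
insertStable-All pa [] = pa ∷ []
insertStable-All {a = a} pa (_∷_ {b} pb pw) with key a ≤ᵇ key b
... | true  = pa ∷ pb ∷ pw
... | false = pb ∷ insertStable-All pa pw

AIO-All : ∀ {P : Letter → Set} {w} → All P w → All P (AIO w)
AIO-All []         = []
AIO-All (pa ∷ pw) = insertStable-All pa (AIO-All pw)

insertStable-least : ∀ {a w} → All (λ c → key a ≤ key c) w → insertStable a w ≡ a ∷ w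
insertStable-least [] = refl
insertStable-least {a} (_∷_ {b} a≤b _) with key a ≤ᵇ key b | ≤⇒≤ᵇ a≤b
... | true | _ = refl

AIO-cons : ∀ {a w} → All (λ c → key a ≤ key c) w → AIO (a ∷ w) ≡ a ∷ AIO w
AIO-cons a≤w = insertStable-least (AIO-All a≤w)

reduceStep-All : ∀ {P : Letter → Set} {a w} → P a → All P w → All P (reduceStep a w)
reduceStep-All pa [] = pa ∷ []
reduceStep-All {a = a} pa (_∷_ {b} pb pw) with cancels a b
... | true  = pw
... | false = pa ∷ pb ∷ pw

reduce-All : ∀ {P : Letter → Set} {w} → All P w → All P (reduce w)
reduce-All []        = []
reduce-All (pa ∷ pw) = reduceStep-All pa (reduce-All pw)

reduceStep-keep : ∀ {a w} → All (λ c → ¬ T (cancels a c)) w → reduceStep a w ≡ a ∷ w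
reduceStep-keep [] = refl
reduceStep-keep {a} (_∷_ {b} a≁b _) with cancels a b
... | true  = ⊥-elim (a≁b _)
... | false = refl

reduceStep-cancel : ∀ {a b w} → T (cancels a b) → reduceStep a (b ∷ w) ≡ w
reduceStep-cancel {a} {b} h with cancels a b
... | true = refl

reduce-cons : ∀ {a w} → All (λ c → ¬ T (cancels a c)) w → reduce (a ∷ w) ≡ a ∷ reduce w
reduce-cons a≁w = reduceStep-keep (reduce-All a≁w)

cancels⇒≡key : ∀ a c → T (cancels a c) → key a ≡ key c
cancels⇒≡key (letter X i _) (letter X j _) h = cong (2 *ℕ_) (≡ᵇ⇒≡ i j (proj₁ (Equivalence.to T-∧ h)))
cancels⇒≡key (letter Y i _) (letter Y j _) h = cong (suc ∘ (2 *ℕ_)) (≡ᵇ⇒≡ i j (proj₁ (Equivalence.to T-∧ h)))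

≺⇒¬cancels : ∀ {a c} → a ≺ c → ¬ T (cancels a c)
≺⇒¬cancels {a} {c} a≺c h = <-irrefl (cancels⇒≡key a c h) (key< a≺c)

cancels-⁻¹ : ∀ c → T (cancels c (c ⁻¹))
cancels-⁻¹ (letter X j false) = Equivalence.from T-∧ (≡⇒≡ᵇ j j refl , _)
cancels-⁻¹ (letter X j true)  = Equivalence.from T-∧ (≡⇒≡ᵇ j j refl , _)
cancels-⁻¹ (letter Y j false) = Equivalence.from T-∧ (≡⇒≡ᵇ j j refl , _)
cancels-⁻¹ (letter Y j true)  = Equivalence.from T-∧ (≡⇒≡ᵇ j j refl , _)

nf : Word → Word
nf w = reduce (AIO w)

nf-cons : ∀ {a w} → All (a ≺_) w → nf (a ∷ w) ≡ a ∷ nf w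
nf-cons a≺w = trans (cong reduce (AIO-cons (All.map (<⇒≤ ∘ key<) a≺w)))
                    (reduce-cons (All.map ≺⇒¬cancels (AIO-All a≺w)))

nf-increasing : ∀ {w} → Increasing w → nf w ≡ w
nf-increasing []            = refl
nf-increasing (a≺w ∷ inc) = trans (nf-cons a≺w) (cong (_ ∷_) (nf-increasing inc))

nf-cancel : ∀ {c w} → Increasing (c ∷ w) → nf (c ∷ c ⁻¹ ∷ w) ≡ w
nf-cancel {c} {w} (c≺w ∷ inc) = begin
    reduce (AIO (c ∷ c ⁻¹ ∷ w))
  ≡⟨ cong reduce (trans (AIO-cons (≤-reflexive (≡.sym (key-⁻¹ c)) ∷ c≤w))
                        (cong (c ∷_) (AIO-cons (All.map (≤-trans (≤-reflexive (key-⁻¹ c))) c≤w)))) ⟩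
    reduceStep c (reduceStep (c ⁻¹) (nf w))
  ≡⟨ cong (reduceStep c ∘ reduceStep (c ⁻¹)) (nf-increasing inc) ⟩
    reduceStep c (reduceStep (c ⁻¹) w)
  ≡⟨ cong (reduceStep c) (reduceStep-keep (All.map (≺⇒¬cancels ∘ ≤-≺-trans {c ⁻¹} (≤-reflexive (key-⁻¹ c))) c≺w)) ⟩
    reduceStep c (c ⁻¹ ∷ w)
  ≡⟨ reduceStep-cancel (cancels-⁻¹ c) ⟩
    w
  ∎
  where
  open ≡.≡-Reasoning
  c≤w = All.map (<⇒≤ ∘ key<) c≺w

nf-cancel-inside : ∀ p {c w} → Increasing (p ++ c ∷ w) → nf (p ++ c ∷ c ⁻¹ ∷ w) ≡ p ++ w
nf-cancel-inside []      inc              = nf-cancel inc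
nf-cancel-inside (a ∷ p) {c} (a≺pcw ∷ inc) = trans (nf-cons a≺pc⁻¹w) (cong (a ∷_) (nf-cancel-inside p inc))
  where
  a≺pc⁻¹w : All (a ≺_) (p ++ c ∷ c ⁻¹ ∷ _)
  a≺pc⁻¹w with ++⁻ p a≺pcw
  ... | a≺p , a≺c ∷ a≺w = ++⁺ a≺p (a≺c ∷ ≺-≤-trans a≺c (≤-reflexive (≡.sym (key-⁻¹ c))) ∷ a≺w)

-- D on increasing words

Increasing-rule-positive : ∀ {s j r} → Increasing (letter s j false ∷ r) → Increasing (yL j ∷ xL (suc j) ∷ up r)
Increasing-rule-positive {s} {j} inc =
  Increasing-∷ (≺-idx (n<1+n j)) (Increasing-lowerHead (2*idx≤key (letter s (suc j) false)) (Increasing-up inc))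

Increasing-rule-xI : ∀ {j r} → Increasing (xI j ∷ r) → Increasing (xI j ∷ yL j ∷ xL (suc j) ∷ up r)
Increasing-rule-xI {j} inc =
  Increasing-∷ (X≺Y j true false) (Increasing-∷ (≺-idx (n<1+n j)) (Increasing-lowerHead ≤-refl (Increasing-up inc)))

Increasing-rule-yI : ∀ {j r} → Increasing (yI j ∷ r) → Increasing (yI j ∷ xL (suc j) ∷ yI (suc j) ∷ up r)
Increasing-rule-yI {j} inc =
  Increasing-∷ (≺-idx (n<1+n j)) (Increasing-∷ (X≺Y (suc j) false true) (Increasing-up inc))

mapWord : (Word → Word) → Term → Term
mapWord f t = term (coef t) (qexp t) (f (word t))

-- splitTerms and consSplit are the functions used inside Dword and splits, so that
-- Dword w ≡ concatMap splitTerms (splits w) holds definitionally.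
splitTerms : Word × Letter × Word → Elem
splitTerms (p , a , r) = map (mapWord (λ w → nf (p ++ w ++ up r))) (Rule a)

consSplit : Letter → Word × Letter × Word → Word × Letter × Word
consSplit a (p , b , r) = (a ∷ p , b , r)

AllIn : (Letter → Set) → Word × Letter × Word → Set
AllIn P (p , b , r) = All P p × P b × All P r

splits-All : ∀ {P : Letter → Set} {w} → All P w → All (AllIn P) (splits w)
splits-All []        = []
splits-All (pa ∷ pw) = ([] , pa , pw) ∷ map⁺ (All.map (λ { (pp , pb , pr) → pa ∷ pp , pb , pr }) (splits-All pw))

≺-ruleCore : ∀ {a b} → a ≺ b → All (a ≺_) (yL (idx b) ∷ xL (suc (idx b)) ∷ [])
≺-ruleCore {b = b} a≺b = a≺y ∷ ≺-trans a≺y (≺-idx (n<1+n (idx b))) ∷ []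
  where
  a≺y = ≺-≤-trans a≺b (key≤1+2*idx b)

All-≺-up : ∀ {a r} → All (a ≺_) r → All (a ≺_) (up r)
All-≺-up a≺r = map⁺ (All.map ≺-shiftLʳ a≺r)

splitTerms-cons : ∀ {a} s → AllIn (a ≺_) s → splitTerms (consSplit a s) ≡ map (mapWord (a ∷_)) (splitTerms s)
splitTerms-cons (p , letter s j false , r) (a≺p , a≺b , a≺r) =
  cong (λ w → term (ℤ.+ 1) j w ∷ []) (nf-cons (++⁺ a≺p (++⁺ (≺-ruleCore a≺b) (All-≺-up a≺r))))
splitTerms-cons (p , letter s j true , r) (a≺p , a≺b , a≺r) =
  cong (λ w → term -[1+ 0 ] j w ∷ [])
       (nf-cons (++⁺ a≺p (a≺b ∷ ++⁺ (≺-ruleCore a≺b) (≺-shiftLʳ a≺b ∷ All-≺-up a≺r))))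

concatMap-consSplit : ∀ {a} L → All (AllIn (a ≺_)) L →
  concatMap splitTerms (map (consSplit a) L) ≡ map (mapWord (a ∷_)) (concatMap splitTerms L)
concatMap-consSplit []      []       = refl
concatMap-consSplit (s ∷ L) (h ∷ hL) =
  trans (cong₂ _++_ (splitTerms-cons s h) (concatMap-consSplit L hL))
        (≡.sym (map-++ _ (splitTerms s) (concatMap splitTerms L)))

Dword-cons : ∀ {a r} → All (a ≺_) r →
  Dword (a ∷ r) ≡ map (mapWord (λ w → nf (w ++ up r))) (Rule a) ++ map (mapWord (a ∷_)) (Dword r)
Dword-cons {a} {r} a≺r = cong (splitTerms ([] , a , r) ++_) (concatMap-consSplit (splits r) (splits-All a≺r))

-- Evaluation in a commutative ring

module Evaluation {c ℓ} (R : CommutativeRing c ℓ) where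
  open CommutativeRing R hiding (zero) renaming (refl to ≈-refl; sym to ≈-sym; trans to ≈-trans)
  open InRing R
  open import Relation.Binary.Reasoning.Setoid setoid
  open import Algebra.Properties.Ring ring using (-‿distribˡ-*; -‿distribʳ-*; x[y-z]≈xy-xz; [y-z]x≈yx-zx)
  open import Algebra.Properties.AbelianGroup +-abelianGroup using (⁻¹-∙-comm; ⁻¹-involutive; ε⁻¹≈ε)
  open import Algebra.Properties.CommutativeSemigroup +-commutativeSemigroup using (interchange)
  import Algebra.Properties.Semiring.Mult semiring as Mult
  import Algebra.Properties.Semiring.Exp semiring as Exp
  import Algebra.Properties.CommutativeSemiring.Exp commutativeSemiring as CExp
  open import Algebra.Solver.Ring.NaturalCoefficients.Default commutativeSemiring
    using (solve; _:=_; _:+_; _:*_; con)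

  natR≡× : ∀ n → natR n ≡ n Mult.× 1#
  natR≡× zero    = ≡.refl
  natR≡× (suc n) = ≡.cong (_+_ 1#) (natR≡× n)

  natR-* : ∀ m n → natR (m *ℕ n) ≈ natR m * natR n
  natR-* m n rewrite natR≡× (m *ℕ n) | natR≡× m | natR≡× n = Mult.×1-homo-* m n

  intR-+◃ : ∀ n → intR (Sign.+ ◃ n) ≈ natR n
  intR-+◃ zero    = ≈-refl
  intR-+◃ (suc n) = ≈-refl

  intR--◃ : ∀ n → intR (Sign.- ◃ n) ≈ - natR n
  intR--◃ zero    = ≈-sym ε⁻¹≈ε
  intR--◃ (suc n) = ≈-refl

  intR-* : ∀ a b → intR (a *ℤ b) ≈ intR a * intR b
  intR-* (ℤ.+ m)   (ℤ.+ n)    = ≈-trans (intR-+◃ (m *ℕ n)) (natR-* m n)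
  intR-* (ℤ.+ m)   -[1+ n ] = begin
    intR (Sign.- ◃ m *ℕ suc n)      ≈⟨ intR--◃ (m *ℕ suc n) ⟩
    - natR (m *ℕ suc n)             ≈⟨ -‿cong (natR-* m (suc n)) ⟩
    - (natR m * natR (suc n))       ≈⟨ -‿distribʳ-* _ _ ⟩
    natR m * - natR (suc n)         ∎
  intR-* -[1+ m ] (ℤ.+ n)  = begin
    intR (Sign.- ◃ suc m *ℕ n)      ≈⟨ intR--◃ (suc m *ℕ n) ⟩
    - natR (suc m *ℕ n)             ≈⟨ -‿cong (natR-* (suc m) n) ⟩
    - (natR (suc m) * natR n)       ≈⟨ -‿distribˡ-* _ _ ⟩
    - natR (suc m) * natR n         ∎
  intR-* -[1+ m ] -[1+ n ] = begin
    intR (Sign.+ ◃ suc m *ℕ suc n)         ≈⟨ intR-+◃ (suc m *ℕ suc n) ⟩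
    natR (suc m *ℕ suc n)                  ≈⟨ natR-* (suc m) (suc n) ⟩
    natR (suc m) * natR (suc n)            ≈⟨ ⁻¹-involutive _ ⟨
    - - (natR (suc m) * natR (suc n))      ≈⟨ -‿cong (-‿distribˡ-* _ _) ⟩
    - (- natR (suc m) * natR (suc n))      ≈⟨ -‿distribʳ-* _ _ ⟩
    - natR (suc m) * - natR (suc n)        ∎

  ^≡^ : ∀ a n → a ^ n ≡ a Exp.^ n
  ^≡^ a zero    = ≡.refl
  ^≡^ a (suc n) = ≡.cong (a *_) (^≡^ a n)

  ^-homo-* : ∀ a m n → a ^ (m +ℕ n) ≈ a ^ m * a ^ n
  ^-homo-* a m n rewrite ^≡^ a (m +ℕ n) | ^≡^ a m | ^≡^ a n = Exp.^-homo-* a m n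

  ^-distrib-* : ∀ a b n → (a * b) ^ n ≈ a ^ n * b ^ n
  ^-distrib-* a b n rewrite ^≡^ (a * b) n | ^≡^ a n | ^≡^ b n = CExp.^-distrib-* a b n

  [x+y]-[z+w]≈[x-z]+[y-w] : ∀ x y z w → (x + y) - (z + w) ≈ (x - z) + (y - w)
  [x+y]-[z+w]≈[x-z]+[y-w] x y z w = ≈-trans (+-congˡ (≈-sym (⁻¹-∙-comm z w))) (interchange x y (- z) (- w))

  [x+y]-[x+z]≈y-z : ∀ x y z → (x + y) - (x + z) ≈ y - z
  [x+y]-[x+z]≈y-z x y z = begin
    (x + y) - (x + z)      ≈⟨ [x+y]-[z+w]≈[x-z]+[y-w] x y x z ⟩
    (x - x) + (y - z)      ≈⟨ +-congʳ (-‿inverseʳ x) ⟩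
    0# + (y - z)           ≈⟨ +-identityˡ _ ⟩
    y - z                  ∎

  [-x]*[y*z]≈[-[y*x]]*z : ∀ x y z → (- x) * (y * z) ≈ (- (y * x)) * z
  [-x]*[y*z]≈[-[y*x]]*z x y z = begin
    (- x) * (y * z)        ≈⟨ *-assoc _ _ _ ⟨
    (- x) * y * z          ≈⟨ *-congʳ (-‿distribˡ-* x y) ⟨
    (- (x * y)) * z        ≈⟨ *-congʳ (-‿cong (*-comm x y)) ⟩
    (- (y * x)) * z        ∎

  x*[[-y]*z]≈0-x*[y*z] : ∀ x y z → x * ((- y) * z) ≈ 0# - x * (y * z)
  x*[[-y]*z]≈0-x*[y*z] x y z = begin
    x * ((- y) * z)        ≈⟨ *-congˡ (-‿distribˡ-* y z) ⟨
    x * (- (y * z))        ≈⟨ -‿distribʳ-* x _ ⟨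
    - (x * (y * z))        ≈⟨ +-identityˡ _ ⟨
    0# - x * (y * z)       ∎

  [-x]*y+x*z≈x*[z-y] : ∀ x y z → (- x) * y + x * z ≈ x * (z - y)
  [-x]*y+x*z≈x*[z-y] x y z = begin
    (- x) * y + x * z      ≈⟨ +-congʳ (-‿distribˡ-* x y) ⟨
    - (x * y) + x * z      ≈⟨ +-comm _ _ ⟩
    x * z - x * y          ≈⟨ x[y-z]≈xy-xz x z y ⟨
    x * (z - y)            ∎

  intR+1*x*y+0≈x*y : ∀ a b → intR (ℤ.+ 1) * a * b + 0# ≈ a * b
  intR+1*x*y+0≈x*y a b = ≈-trans (+-identityʳ _) (*-congʳ (≈-trans (*-congʳ (+-identityʳ 1#)) (*-identityˡ a)))

  intR-1*x*y+0≈[-x]*y : ∀ a b → intR -[1+ 0 ] * a * b + 0# ≈ (- a) * b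
  intR-1*x*y+0≈[-x]*y a b = ≈-trans (+-identityʳ _)
    (*-congʳ (≈-trans (≈-sym (-‿distribˡ-* _ a)) (-‿cong (≈-trans (*-congʳ (+-identityʳ 1#)) (*-identityˡ a)))))

  module _ (q : Carrier) where

    -- Φ.φ q x x⁻¹ y y⁻¹ is definitionally eval φW.
    eval : (Word → Carrier) → Elem → Carrier
    eval g = foldr (λ t r → intR (coef t) * q ^ qexp t * g (word t) + r) 0#

    eval-++ : ∀ g E F → eval g (E ++ F) ≈ eval g E + eval g F
    eval-++ g []      F = ≈-sym (+-identityˡ _)
    eval-++ g (t ∷ E) F = ≈-trans (+-congˡ (eval-++ g E F)) (≈-sym (+-assoc _ _ _))

    eval-mapWord : ∀ g f E → eval g (map (mapWord f) E) ≡ eval (g ∘ f) E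
    eval-mapWord g f []      = ≡.refl
    eval-mapWord g f (t ∷ E) = ≡.cong (_ +_) (eval-mapWord g f E)

    scaleTerm : Term → Term → Term
    scaleTerm t t′ = term (coef t *ℤ coef t′) (qexp t +ℕ qexp t′) (word t′)

    eval-scaleTerm : ∀ g t E → eval g (map (scaleTerm t) E) ≈ intR (coef t) * q ^ qexp t * eval g E
    eval-scaleTerm g t []       = ≈-sym (zeroʳ _)
    eval-scaleTerm g t (t′ ∷ E) = begin
        intR (coef t *ℤ coef t′) * q ^ (qexp t +ℕ qexp t′) * g (word t′) + eval g (map (scaleTerm t) E)
      ≈⟨ +-cong (*-congʳ (*-cong (intR-* (coef t) (coef t′)) (^-homo-* q (qexp t) (qexp t′))))
                (eval-scaleTerm g t E) ⟩
        a * a′ * (b * b′) * g (word t′) + a * b * eval g E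
      ≈⟨ solve 6 (λ a a′ b b′ G E → a :* a′ :* (b :* b′) :* G :+ a :* b :* E := a :* b :* (a′ :* b′ :* G :+ E))
               ≈-refl a a′ b b′ (g (word t′)) (eval g E) ⟩
        a * b * (a′ * b′ * g (word t′) + eval g E)
      ∎
      where
      a = intR (coef t)
      a′ = intR (coef t′)
      b = q ^ qexp t
      b′ = q ^ qexp t′

    Dᵀ : (Word → Carrier) → Word → Carrier
    Dᵀ g w = eval g (Dword w)

    eval-D : ∀ g E → eval g (D E) ≈ eval (Dᵀ g) E
    eval-D g []      = ≈-refl
    eval-D g (t ∷ E) = ≈-trans (eval-++ g (map (scaleTerm t) (Dword (word t))) (D E))
                               (+-cong (eval-scaleTerm g t (Dword (word t))) (eval-D g E))

    eval-single : ∀ g a → eval g (single a) ≈ g (a ∷ [])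
    eval-single g a = ≈-trans (intR+1*x*y+0≈x*y 1# _) (*-identityˡ _)

    Dᵀ-cons : ∀ g {a r} → All (a ≺_) r →
      Dᵀ g (a ∷ r) ≈ eval (λ w → g (nf (w ++ up r))) (Rule a) + Dᵀ (λ w → g (a ∷ w)) r
    Dᵀ-cons g {a} {r} a≺r = begin
        eval g (Dword (a ∷ r))
      ≡⟨ ≡.cong (eval g) (Dword-cons a≺r) ⟩
        eval g (map (mapWord (λ w → nf (w ++ up r))) (Rule a) ++ map (mapWord (a ∷_)) (Dword r))
      ≈⟨ eval-++ g (map (mapWord (λ w → nf (w ++ up r))) (Rule a)) (map (mapWord (a ∷_)) (Dword r)) ⟩
        eval g (map (mapWord (λ w → nf (w ++ up r))) (Rule a)) + eval g (map (mapWord (a ∷_)) (Dword r))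
      ≡⟨ ≡.cong₂ _+_ (eval-mapWord g _ (Rule a)) (eval-mapWord g _ (Dword r)) ⟩
        eval (λ w → g (nf (w ++ up r))) (Rule a) + Dᵀ (λ w → g (a ∷ w)) r
      ∎

    Dᵀ-positive : ∀ g {s j r} → Increasing (letter s j false ∷ r) →
      Dᵀ g (letter s j false ∷ r) ≈ q ^ j * g (yL j ∷ xL (suc j) ∷ up r) + Dᵀ (λ w → g (letter s j false ∷ w)) r
    Dᵀ-positive g inc@(a≺r ∷ _) = ≈-trans (Dᵀ-cons g a≺r)
      (+-congʳ (≈-trans (intR+1*x*y+0≈x*y _ _) (*-congˡ (reflexive (≡.cong g (nf-increasing (Increasing-rule-positive inc)))))))

    Dᵀ-xI : ∀ g {j r} → Increasing (xI j ∷ r) →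
      Dᵀ g (xI j ∷ r) ≈ (- q ^ j) * g (xI j ∷ yL j ∷ up r) + Dᵀ (λ w → g (xI j ∷ w)) r
    Dᵀ-xI g {j} inc@(a≺r ∷ _) = ≈-trans (Dᵀ-cons g a≺r)
      (+-congʳ (≈-trans (intR-1*x*y+0≈[-x]*y _ _)
        (*-congˡ (reflexive (≡.cong g (nf-cancel-inside (xI j ∷ yL j ∷ []) (Increasing-rule-xI inc)))))))

    Dᵀ-yI : ∀ g {j r} → Increasing (yI j ∷ r) →
      Dᵀ g (yI j ∷ r) ≈ (- q ^ j) * g (xL (suc j) ∷ yI (suc j) ∷ up r) + Dᵀ (λ w → g (yI j ∷ w)) r
    Dᵀ-yI g inc@(a≺r ∷ _) = ≈-trans (Dᵀ-cons g a≺r)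
      (+-congʳ (≈-trans (intR-1*x*y+0≈[-x]*y _ _)
        (*-congˡ (reflexive (≡.cong g (nf-cancel-inside [] (Increasing-rule-yI inc)))))))

    module Chain (a b : Sym) (base : ℕ → Word)
                 (base-increasing : ∀ j → IncreasingFrom j (base j))
                 (up-base : ∀ j → up (base j) ≡ base (suc j)) where

      -- chain k j g is g applied linearly to (a_j − b_j)(a_{j+1} − b_{j+1}) ⋯ (a_{j+k−1} − b_{j+k−1}) · base (j + k).
      chain : ℕ → ℕ → (Word → Carrier) → Carrier
      chain zero    j g = g (base j)
      chain (suc k) j g = chain k (suc j) (λ w → g (letter a j false ∷ w))
                        - chain k (suc j) (λ w → g (letter b j false ∷ w))

      chain-cong : ∀ k j {g h} → (∀ w → IncreasingFrom j w → g w ≈ h w) → chain k j g ≈ chain k j h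
      chain-cong zero    j g≈h = g≈h _ (base-increasing j)
      chain-cong (suc k) j g≈h =
        +-cong (chain-cong k (suc j) (λ _ inc → g≈h _ (IncreasingFrom-∷ a false inc)))
               (-‿cong (chain-cong k (suc j) (λ _ inc → g≈h _ (IncreasingFrom-∷ b false inc))))

      chain-+ : ∀ k j g h → chain k j (λ w → g w + h w) ≈ chain k j g + chain k j h
      chain-+ zero    j g h = ≈-refl
      chain-+ (suc k) j g h = ≈-trans (+-cong (chain-+ k (suc j) _ _) (-‿cong (chain-+ k (suc j) _ _)))
                                      ([x+y]-[z+w]≈[x-z]+[y-w] _ _ _ _)

      chain-* : ∀ k j x g → chain k j (λ w → x * g w) ≈ x * chain k j g
      chain-* zero    j x g = ≈-refl
      chain-* (suc k) j x g = ≈-trans (+-cong (chain-* k (suc j) x _) (-‿cong (chain-* k (suc j) x _)))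
                                      (≈-sym (x[y-z]≈xy-xz x _ _))

      chain-up : ∀ k j g → chain k j (g ∘ up) ≈ chain k (suc j) g
      chain-up zero    j g = reflexive (≡.cong g (up-base j))
      chain-up (suc k) j g = +-cong (chain-up k (suc j) _) (-‿cong (chain-up k (suc j) _))

      chain-multiplicative : ∀ {g α β γ} →
        (∀ j w → g (letter a j false ∷ w) ≈ α * g w) → (∀ j w → g (letter b j false ∷ w) ≈ β * g w) →
        (∀ j → g (base j) ≈ γ) → ∀ k j → chain k j g ≈ (α - β) ^ k * γ
      chain-multiplicative _   _   g-γ zero    j = ≈-trans (g-γ j) (≈-sym (*-identityˡ _))
      chain-multiplicative {g} {α} {β} {γ} g-a g-b g-γ (suc k) j = begin
          chain k (suc j) (λ w → g (letter a j false ∷ w)) - chain k (suc j) (λ w → g (letter b j false ∷ w))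
        ≈⟨ +-cong (chain-cong k (suc j) (λ w _ → g-a j w)) (-‿cong (chain-cong k (suc j) (λ w _ → g-b j w))) ⟩
          chain k (suc j) (λ w → α * g w) - chain k (suc j) (λ w → β * g w)
        ≈⟨ +-cong (chain-* k (suc j) α g) (-‿cong (chain-* k (suc j) β g)) ⟩
          α * chain k (suc j) g - β * chain k (suc j) g
        ≈⟨ [y-z]x≈yx-zx _ α β ⟨
          (α - β) * chain k (suc j) g
        ≈⟨ *-congˡ (chain-multiplicative g-a g-b g-γ k (suc j)) ⟩
          (α - β) * ((α - β) ^ k * γ)
        ≈⟨ *-assoc _ _ _ ⟨
          (α - β) ^ suc k * γ
        ∎

      -- R(a_j) = R(b_j), so the terms where D hits the leading letter cancel.
      chain-Dᵀ : ∀ k j g → chain (suc k) j (Dᵀ g)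
        ≈ chain k (suc j) (Dᵀ (λ w → g (letter a j false ∷ w))) - chain k (suc j) (Dᵀ (λ w → g (letter b j false ∷ w)))
      chain-Dᵀ k j g = ≈-trans (+-cong (split a) (-‿cong (split b))) ([x+y]-[x+z]≈y-z _ _ _)
        where
        split : ∀ s → chain k (suc j) (λ w → Dᵀ g (letter s j false ∷ w))
          ≈ chain k (suc j) (λ w → q ^ j * g (yL j ∷ xL (suc j) ∷ up w)) + chain k (suc j) (Dᵀ (λ w → g (letter s j false ∷ w)))
        split s = ≈-trans (chain-cong k (suc j) (λ _ inc → Dᵀ-positive g (proj₁ (IncreasingFrom-∷ s false inc))))
                          (chain-+ k (suc j) _ _)

      chain-Dᵀ-vanishes : (∀ g j → Dᵀ g (base j) ≈ 0#) → ∀ k j g → chain k j (Dᵀ g) ≈ 0#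
      chain-Dᵀ-vanishes Dᵀ-base zero    j g = Dᵀ-base g j
      chain-Dᵀ-vanishes Dᵀ-base (suc k) j g = begin
          chain (suc k) j (Dᵀ g)
        ≈⟨ chain-Dᵀ k j g ⟩
          chain k (suc j) (Dᵀ _) - chain k (suc j) (Dᵀ _)
        ≈⟨ +-cong (chain-Dᵀ-vanishes Dᵀ-base k (suc j) _) (-‿cong (chain-Dᵀ-vanishes Dᵀ-base k (suc j) _)) ⟩
          0# - 0#
        ≈⟨ -‿inverseʳ 0# ⟩
          0#
        ∎

      chain-Dᵀ-shift : (∀ g j → Dᵀ g (base j) ≈ q ^ j * chain 1 j g) →
        ∀ k j g → chain k j (Dᵀ g) ≈ q ^ (j +ℕ k) * chain (suc k) j g
      chain-Dᵀ-shift Dᵀ-base zero    j g =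
        ≈-trans (Dᵀ-base g j) (*-congʳ (reflexive (≡.cong (q ^_) (≡.sym (ℕₚ.+-identityʳ j)))))
      chain-Dᵀ-shift Dᵀ-base (suc k) j g = begin
          chain (suc k) j (Dᵀ g)
        ≈⟨ chain-Dᵀ k j g ⟩
          chain k (suc j) (Dᵀ gᵃ) - chain k (suc j) (Dᵀ gᵇ)
        ≈⟨ +-cong (chain-Dᵀ-shift Dᵀ-base k (suc j) gᵃ) (-‿cong (chain-Dᵀ-shift Dᵀ-base k (suc j) gᵇ)) ⟩
          q ^ (suc j +ℕ k) * chain (suc k) (suc j) gᵃ - q ^ (suc j +ℕ k) * chain (suc k) (suc j) gᵇ
        ≈⟨ x[y-z]≈xy-xz _ _ _ ⟨
          q ^ (suc j +ℕ k) * chain (suc (suc k)) j g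
        ≈⟨ *-congʳ (reflexive (≡.cong (q ^_) (≡.sym (ℕₚ.+-suc j k)))) ⟩
          q ^ (j +ℕ suc k) * chain (suc (suc k)) j g
        ∎
        where
        gᵃ gᵇ : Word → Carrier
        gᵃ w = g (letter a j false ∷ w)
        gᵇ w = g (letter b j false ∷ w)

    module XChain = Chain X Y (λ _ → []) (λ _ → [] , []) (λ _ → ≡.refl)

    Dᵀ-xI-yL : ∀ g {i z} → IncreasingFrom (suc i) z → Dᵀ g (xI i ∷ yL i ∷ z)
      ≈ (- q ^ i) * g (xI i ∷ yL i ∷ yL (suc i) ∷ up z)
        + (q ^ i * g (xI i ∷ yL i ∷ xL (suc i) ∷ up z) + Dᵀ (λ w → g (xI i ∷ yL i ∷ w)) z)
    Dᵀ-xI-yL g {i} inc = ≈-trans (Dᵀ-xI g (Increasing-∷ (X≺Y i true false) y∷z)) (+-congˡ (Dᵀ-positive _ y∷z))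
      where
      y∷z = proj₁ (IncreasingFrom-∷ Y false inc)

    chain-Dᵀ-xI-yL : ∀ i k g →
      XChain.chain k (suc i) (λ w → Dᵀ g (xI i ∷ yL i ∷ w))
        ≈ q ^ i * XChain.chain (suc k) (suc i) (λ w → g (xI i ∷ yL i ∷ w))
    chain-Dᵀ-xI-yL i k g = begin
        chain k (suc i) (λ w → Dᵀ g (xI i ∷ yL i ∷ w))
      ≈⟨ chain-cong k (suc i) (λ _ → Dᵀ-xI-yL g) ⟩
        chain k (suc i) (λ w → (- q ^ i) * Gʸ (up w) + (q ^ i * Gˣ (up w) + Dᵀ G w))
      ≈⟨ ≈-trans (chain-+ k (suc i) _ _) (+-congˡ (chain-+ k (suc i) _ _)) ⟩
        chain k (suc i) (λ w → (- q ^ i) * Gʸ (up w))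
          + (chain k (suc i) (λ w → q ^ i * Gˣ (up w)) + chain k (suc i) (Dᵀ G))
      ≈⟨ +-cong (chain-* k (suc i) _ _) (+-cong (chain-* k (suc i) _ _) (chain-Dᵀ-vanishes (λ _ _ → ≈-refl) k (suc i) G)) ⟩
        (- q ^ i) * chain k (suc i) (Gʸ ∘ up) + (q ^ i * chain k (suc i) (Gˣ ∘ up) + 0#)
      ≈⟨ +-cong (*-congˡ (chain-up k (suc i) Gʸ)) (≈-trans (+-identityʳ _) (*-congˡ (chain-up k (suc i) Gˣ))) ⟩
        (- q ^ i) * chain k (suc (suc i)) Gʸ + q ^ i * chain k (suc (suc i)) Gˣ
      ≈⟨ [-x]*y+x*z≈x*[z-y] _ _ _ ⟩
        q ^ i * chain (suc k) (suc i) G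
      ∎
      where
      open XChain
      G Gˣ Gʸ : Word → Carrier
      G w = g (xI i ∷ yL i ∷ w)
      Gˣ w = G (xL (suc i) ∷ w)
      Gʸ w = G (yL (suc i) ∷ w)

    Dⁿ-xI : ∀ i k g → eval g (Dⁿ (suc k) (single (xI i)))
      ≈ (- (q ^ i) ^ suc k) * XChain.chain k (suc i) (λ w → g (xI i ∷ yL i ∷ w))
    Dⁿ-xI i zero g = begin
        eval g (D (single (xI i)))
      ≈⟨ ≈-trans (eval-D g (single (xI i))) (eval-single (Dᵀ g) (xI i)) ⟩
        Dᵀ g (xI i ∷ [])
      ≈⟨ ≈-trans (Dᵀ-xI g ([] ∷ [])) (+-identityʳ _) ⟩
        (- q ^ i) * g (xI i ∷ yL i ∷ [])
      ≈⟨ *-congʳ (-‿cong (*-identityʳ _)) ⟨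
        (- (q ^ i) ^ 1) * g (xI i ∷ yL i ∷ [])
      ∎
    Dⁿ-xI i (suc k) g = begin
        eval g (D (Dⁿ (suc k) (single (xI i))))
      ≈⟨ eval-D g (Dⁿ (suc k) (single (xI i))) ⟩
        eval (Dᵀ g) (Dⁿ (suc k) (single (xI i)))
      ≈⟨ Dⁿ-xI i k (Dᵀ g) ⟩
        (- (q ^ i) ^ suc k) * XChain.chain k (suc i) (λ w → Dᵀ g (xI i ∷ yL i ∷ w))
      ≈⟨ *-congˡ (chain-Dᵀ-xI-yL i k g) ⟩
        (- (q ^ i) ^ suc k) * (q ^ i * XChain.chain (suc k) (suc i) (λ w → g (xI i ∷ yL i ∷ w)))
      ≈⟨ [-x]*[y*z]≈[-[y*x]]*z _ _ _ ⟩
        (- (q ^ i) ^ suc (suc k)) * XChain.chain (suc k) (suc i) (λ w → g (xI i ∷ yL i ∷ w))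
      ∎

    module YChain = Chain Y X (λ j → xL j ∷ yI j ∷ [])
                          (λ j → ((X≺Y j false true ∷ []) ∷ [] ∷ []) , ≤-refl ∷ ≤-refl ∷ [])
                          (λ _ → ≡.refl)

    Dᵀ-yChain-base : ∀ g j → Dᵀ g (xL j ∷ yI j ∷ []) ≈ q ^ j * YChain.chain 1 j g
    Dᵀ-yChain-base g j = begin
        Dᵀ g (xL j ∷ yI j ∷ [])
      ≈⟨ Dᵀ-positive g ((X≺Y j false true ∷ []) ∷ [] ∷ []) ⟩
        q ^ j * g (yL j ∷ base) + Dᵀ (λ w → g (xL j ∷ w)) (yI j ∷ [])
      ≈⟨ +-congˡ (≈-trans (Dᵀ-yI (λ w → g (xL j ∷ w)) {j} ([] ∷ [])) (+-identityʳ _)) ⟩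
        q ^ j * g (yL j ∷ base) + (- q ^ j) * g (xL j ∷ base)
      ≈⟨ ≈-trans (+-comm _ _) ([-x]*y+x*z≈x*[z-y] _ _ _) ⟩
        q ^ j * YChain.chain 1 j g
      ∎
      where
      base = xL (suc j) ∷ yI (suc j) ∷ []

    yCoeff : ℕ → ℕ → Carrier
    yCoeff i k = q ^ binom2 (suc k) * (q ^ i) ^ suc k

    yCoeff-suc : ∀ i k → q ^ (suc i +ℕ k) * yCoeff i k ≈ yCoeff i (suc k)
    yCoeff-suc i k = begin
        q * q ^ (i +ℕ k) * (q ^ b * (q ^ i) ^ suc k)
      ≈⟨ *-congʳ (*-congˡ (^-homo-* q i k)) ⟩
        q * (q ^ i * q ^ k) * (q ^ b * (q ^ i) ^ suc k)
      ≈⟨ solve 5 (λ Q Qi Qk Qb P → Q :* (Qi :* Qk) :* (Qb :* P) := Q :* (Qk :* Qb) :* (Qi :* P))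
               ≈-refl q (q ^ i) (q ^ k) (q ^ b) ((q ^ i) ^ suc k) ⟩
        q * (q ^ k * q ^ b) * (q ^ i * (q ^ i) ^ suc k)
      ≈⟨ *-congʳ (*-congˡ (^-homo-* q k b)) ⟨
        q * q ^ (k +ℕ b) * (q ^ i * (q ^ i) ^ suc k)
      ∎
      where
      b = binom2 (suc k)

    Dⁿ-yI : ∀ i k g → eval g (Dⁿ (suc k) (single (yI i))) ≈ (- yCoeff i k) * YChain.chain k (suc i) g
    Dⁿ-yI i zero g = begin
        eval g (D (single (yI i)))
      ≈⟨ ≈-trans (eval-D g (single (yI i))) (eval-single (Dᵀ g) (yI i)) ⟩
        Dᵀ g (yI i ∷ [])
      ≈⟨ ≈-trans (Dᵀ-yI g ([] ∷ [])) (+-identityʳ _) ⟩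
        (- q ^ i) * g (xL (suc i) ∷ yI (suc i) ∷ [])
      ≈⟨ *-congʳ (-‿cong (≈-trans (*-identityˡ _) (*-identityʳ _))) ⟨
        (- yCoeff i 0) * g (xL (suc i) ∷ yI (suc i) ∷ [])
      ∎
    Dⁿ-yI i (suc k) g = begin
        eval g (D (Dⁿ (suc k) (single (yI i))))
      ≈⟨ eval-D g (Dⁿ (suc k) (single (yI i))) ⟩
        eval (Dᵀ g) (Dⁿ (suc k) (single (yI i)))
      ≈⟨ Dⁿ-yI i k (Dᵀ g) ⟩
        (- yCoeff i k) * YChain.chain k (suc i) (Dᵀ g)
      ≈⟨ *-congˡ (YChain.chain-Dᵀ-shift Dᵀ-yChain-base k (suc i) g) ⟩
        (- yCoeff i k) * (q ^ (suc i +ℕ k) * YChain.chain (suc k) (suc i) g)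
      ≈⟨ [-x]*[y*z]≈[-[y*x]]*z _ _ _ ⟩
        (- (q ^ (suc i +ℕ k) * yCoeff i k)) * YChain.chain (suc k) (suc i) g
      ≈⟨ *-congʳ (-‿cong (yCoeff-suc i k)) ⟩
        (- yCoeff i (suc k)) * YChain.chain (suc k) (suc i) g
      ∎

    module _ (x x⁻¹ y y⁻¹ : Carrier) where
      open Φ q x x⁻¹ y y⁻¹ using (φW)

      Gen-xI : x * x⁻¹ ≈ 1# → ∀ i →
        ((x - y) · Gen q x x⁻¹ y y⁻¹ (single (xI i))) ≋ (one ⊖ ((x⁻¹ * y) · e-q ((x - y) * q ^ i)))
      Gen-xI xx⁻¹≈1 i zero = begin
          (x - y) * eval φW (single (xI i))
        ≈⟨ *-congˡ (≈-trans (eval-single φW (xI i)) (*-identityʳ x⁻¹)) ⟩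
          (x - y) * x⁻¹
        ≈⟨ [y-z]x≈yx-zx x⁻¹ x y ⟩
          x * x⁻¹ - y * x⁻¹
        ≈⟨ +-cong xx⁻¹≈1 (-‿cong (≈-trans (*-comm y x⁻¹) (≈-sym (*-identityʳ _)))) ⟩
          1# - x⁻¹ * y * 1#
        ∎
      Gen-xI xx⁻¹≈1 i (suc k) = begin
          (x - y) * eval φW (Dⁿ (suc k) (single (xI i)))
        ≈⟨ *-congˡ (Dⁿ-xI i k φW) ⟩
          (x - y) * ((- P) * XChain.chain k (suc i) (λ w → x⁻¹ * (y * φW w)))
        ≈⟨ *-congˡ (*-congˡ (≈-trans (XChain.chain-* k (suc i) x⁻¹ _) (*-congˡ (XChain.chain-* k (suc i) y φW)))) ⟩
          (x - y) * ((- P) * (x⁻¹ * (y * XChain.chain k (suc i) φW)))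
        ≈⟨ *-congˡ (*-congˡ (*-congˡ (*-congˡ
             (XChain.chain-multiplicative (λ _ _ → ≈-refl) (λ _ _ → ≈-refl) (λ _ → ≈-refl) k (suc i))))) ⟩
          (x - y) * ((- P) * (x⁻¹ * (y * ((x - y) ^ k * 1#))))
        ≈⟨ x*[[-y]*z]≈0-x*[y*z] _ _ _ ⟩
          0# - (x - y) * (P * (x⁻¹ * (y * ((x - y) ^ k * 1#))))
        ≈⟨ +-congˡ (-‿cong (solve 5 (λ d P u v dᵏ → d :* (P :* (u :* (v :* (dᵏ :* con 1)))) := u :* v :* (d :* dᵏ :* P))
                                   ≈-refl (x - y) P x⁻¹ y ((x - y) ^ k))) ⟩
          0# - x⁻¹ * y * ((x - y) ^ suc k * P)
        ≈⟨ +-congˡ (-‿cong (*-congˡ (^-distrib-* (x - y) (q ^ i) (suc k)))) ⟨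
          0# - x⁻¹ * y * ((x - y) * q ^ i) ^ suc k
        ∎
        where
        P = (q ^ i) ^ suc k

      Gen-yI : y * y⁻¹ ≈ 1# → ∀ i →
        ((y - x) · Gen q x x⁻¹ y y⁻¹ (single (yI i))) ≋ (one ⊖ ((x * y⁻¹) · E-q q ((y - x) * q ^ i)))
      Gen-yI yy⁻¹≈1 i zero = begin
          (y - x) * eval φW (single (yI i))
        ≈⟨ *-congˡ (≈-trans (eval-single φW (yI i)) (*-identityʳ y⁻¹)) ⟩
          (y - x) * y⁻¹
        ≈⟨ [y-z]x≈yx-zx y⁻¹ y x ⟩
          y * y⁻¹ - x * y⁻¹
        ≈⟨ +-cong yy⁻¹≈1 (-‿cong (≈-sym (≈-trans (*-congˡ (*-identityˡ 1#)) (*-identityʳ _)))) ⟩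
          1# - x * y⁻¹ * (1# * 1#)
        ∎
      Gen-yI yy⁻¹≈1 i (suc k) = begin
          (y - x) * eval φW (Dⁿ (suc k) (single (yI i)))
        ≈⟨ *-congˡ (Dⁿ-yI i k φW) ⟩
          (y - x) * ((- yCoeff i k) * YChain.chain k (suc i) φW)
        ≈⟨ *-congˡ (*-congˡ
             (YChain.chain-multiplicative (λ _ _ → ≈-refl) (λ _ _ → ≈-refl) (λ _ → ≈-refl) k (suc i))) ⟩
          (y - x) * ((- yCoeff i k) * ((y - x) ^ k * (x * (y⁻¹ * 1#))))
        ≈⟨ x*[[-y]*z]≈0-x*[y*z] _ _ _ ⟩
          0# - (y - x) * (Qᵇ * P * ((y - x) ^ k * (x * (y⁻¹ * 1#))))
        ≈⟨ +-congˡ (-‿cong (solve 6 (λ d Qᵇ P dᵏ u v → d :* (Qᵇ :* P :* (dᵏ :* (u :* (v :* con 1)))) := u :* v :* (Qᵇ :* (d :* dᵏ :* P)))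
                                   ≈-refl (y - x) Qᵇ P ((y - x) ^ k) x y⁻¹)) ⟩
          0# - x * y⁻¹ * (Qᵇ * ((y - x) ^ suc k * P))
        ≈⟨ +-congˡ (-‿cong (*-congˡ (*-congˡ (^-distrib-* (y - x) (q ^ i) (suc k))))) ⟨
          0# - x * y⁻¹ * (Qᵇ * ((y - x) * q ^ i) ^ suc k)
        ∎
        where
        Qᵇ = q ^ binom2 (suc k)
        P = (q ^ i) ^ suc k

corollary5p6 : ∀ {c ℓ} (R : CommutativeRing c ℓ) →
  let open CommutativeRing R
      open InRing R
  in (q x x⁻¹ y y⁻¹ : Carrier) → x * x⁻¹ ≈ 1# → y * y⁻¹ ≈ 1# → (i : ℕ) →
     ((x - y) · Gen q x x⁻¹ y y⁻¹ (single (xI i)))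
       ≋ (one ⊖ ((x⁻¹ * y) · e-q ((x - y) * q ^ i)))
     × ((y - x) · Gen q x x⁻¹ y y⁻¹ (single (yI i)))
       ≋ (one ⊖ ((x * y⁻¹) · E-q q ((y - x) * q ^ i)))
corollary5p6 R q x x⁻¹ y y⁻¹ xx⁻¹≈1 yy⁻¹≈1 i =
  Evaluation.Gen-xI R q x x⁻¹ y y⁻¹ xx⁻¹≈1 i , Evaluation.Gen-yI R q x x⁻¹ y y⁻¹ yy⁻¹≈1 i
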